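{- Let $\mathbb{C}_1,\dots,\mathbb{C}_n$ and $\mathbb{D}$ be comonads on $\mathcal{C}_1,\dots,\mathcal{C}_n$ and $\mathcal{D}$, let $H\colon\prod_i\mathcal{C}_i\to\mathcal{D}$ be a functor, let $\kappa\colon\mathbb{D}\circ H\Rightarrow H\circ\prod_i\mathbb{C}_i$ be a Kleisli law, and assume $\mathrm{EM}(\mathbb{D})$ has equalisers. Let $(B_i,\beta_i)$ be $\mathbb{C}_i$-coalgebras ($i=1,\dots,n$) and $(A,\alpha)$ a $\mathbb{D}$-coalgebra. Then the map $f\mapsto f^{\#}$ is a bijection between coalgebra morphisms $(A,\alpha)\to\widehat H(\vec\beta)$ in $\mathrm{EM}(\mathbb{D})$ and bimorphisms $\alpha\to[\vec\beta]$.
   Context: Comonads $(\mathbb{C},\varepsilon,\delta)$, $\mathbb{C}$-coalgebras $(A,\alpha)$ (with $\varepsilon_A\circ\alpha=\mathrm{id}$, $\delta_A\circ\alpha=\mathbb{C}(\alpha)\circ\alpha$), coalgebra morphisms ($\beta\circ f=\mathbb{C}(f)\circ\alpha$), the category $\mathrm{EM}(\mathbb{C})$ of coalgebras, and the cofree coalgebra $F^{\mathbb{C}}(A)=(\mathbb{C}(A),\delta_A)$ are as usual. A Kleisli law $\kappa\colon\mathbb{D}\circ H\Rightarrow H\circ\prod_i\mathbb{C}_i$ is a natural transformation with components $\kappa_{\vec A}\colon\mathbb{D}H(A_1,\dots,A_n)\to H(\mathbb{C}_1A_1,\dots,\mathbb{C}_nA_n)$ satisfying $H(\varepsilon_{A_1},\dots,\varepsilon_{A_n})\circ\kappa=\varepsilon_{H(\vec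 A)}$ and $H(\delta_{A_1},\dots,\delta_{A_n})\circ\kappa_{\vec A}=\kappa_{\mathbb{C}_1A_1,\dots}\circ\mathbb{D}(\kappa_{\vec A})\circ\delta_{H(\vec A)}$. For $\mathbb{C}_i$-coalgebras $(B_i,\beta_i)$, let $\iota_{\vec\beta}\colon\widehat H(\vec\beta)\to F^{\mathbb{D}}(H(B_1,\dots,B_n))$ be the equaliser in $\mathrm{EM}(\mathbb{D})$ of the two coalgebra morphisms $\mathbb{D}(\kappa_{\vec B})\circ\delta_{H(\vec B)}$ and $\mathbb{D}(H(\beta_1,\dots,\beta_n))$ from $F^{\mathbb{D}}(H(\vec B))$ to $F^{\mathbb{D}}(H(\mathbb{C}_1B_1,\dots,\mathbb{C}_nB_n))$. Let $u_{\vec\beta}=\varepsilon_{H(\vec B)}\circ\iota_{\vec\beta}$, a morphism of $\mathcal{D}$ from the underlying object of $\widehat H(\vec\beta)$ to $H(\vec B)$. For a coalgebra morphism $f\colon(A,\alpha)\to\widehat H(\vec\beta)$, set $f^{\#}=u_{\vec\beta}\circ f\colon A\to H(\vec B)$. A bimorphism $\alpha\to[\vec\beta]$ is a morphism $g\colon A\to H(B_1,\dots,B_n)$ of $\mathcal{D}$ with $H(\beta_1,\dots,\beta_n)\circ g=\kappa_{\vec B}\circ\mathbb{D}(g)\circ\alpha$. -}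

module Defs where

open import Level using (Level; _⊔_) renaming (suc to lsuc)
open import Data.Nat using (ℕ)
open import Data.Fin using (Fin)
open import Data.Product using (Σ; Σ-syntax; _,_; proj₁; proj₂)
open import Relation.Binary using (Rel; IsEquivalence; Setoid)
import Relation.Binary.Reasoning.Setoid as SetoidReasoning

record Category (o ℓ e : Level) : Set (lsuc (o ⊔ ℓ ⊔ e)) where
  infixr 9 _∘_
  infix  4 _≈_
  field
    Obj       : Set o
    _⇒_       : Obj → Obj → Set ℓ
    _≈_       : ∀ {A B} → Rel (A ⇒ B) e
    id        : ∀ {A} → A ⇒ A
    _∘_       : ∀ {A B C} → B ⇒ C → A ⇒ B → A ⇒ C
    equiv     : ∀ {A B} → IsEquivalence (_≈_ {A} {B})
    ∘-resp-≈  : ∀ {A B C} {f h : B ⇒ C} {g i : A ⇒ B} → f ≈ h → g ≈ i → f ∘ g ≈ h ∘ i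
    assoc     : ∀ {A B C D} {f : A ⇒ B} {g : B ⇒ C} {h : C ⇒ D} →
                (h ∘ g) ∘ f ≈ h ∘ (g ∘ f)
    identityˡ : ∀ {A B} {f : A ⇒ B} → id ∘ f ≈ f
    identityʳ : ∀ {A B} {f : A ⇒ B} → f ∘ id ≈ f

  hom-setoid : ∀ {A B} → Setoid ℓ e
  hom-setoid {A} {B} = record { Carrier = A ⇒ B ; _≈_ = _≈_ ; isEquivalence = equiv }

  module HomReasoning {A B : Obj} = SetoidReasoning (hom-setoid {A} {B})

  refl : ∀ {A B} {f : A ⇒ B} → f ≈ f
  refl = IsEquivalence.refl equiv
  sym : ∀ {A B} {f g : A ⇒ B} → f ≈ g → g ≈ f
  sym = IsEquivalence.sym equiv
  trans : ∀ {A B} {f g h : A ⇒ B} → f ≈ g → g ≈ h → f ≈ h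
  trans = IsEquivalence.trans equiv

record Functor {o ℓ e o′ ℓ′ e′} (C : Category o ℓ e) (D : Category o′ ℓ′ e′)
       : Set (o ⊔ ℓ ⊔ e ⊔ o′ ⊔ ℓ′ ⊔ e′) where
  private
    module C = Category C
    module D = Category D
  field
    F₀           : C.Obj → D.Obj
    F₁           : ∀ {A B} → A C.⇒ B → F₀ A D.⇒ F₀ B
    identity     : ∀ {A} → F₁ (C.id {A}) D.≈ D.id
    homomorphism : ∀ {X Y Z} {f : X C.⇒ Y} {g : Y C.⇒ Z} →
                   F₁ (g C.∘ f) D.≈ F₁ g D.∘ F₁ f
    F-resp-≈     : ∀ {A B} {f g : A C.⇒ B} → f C.≈ g → F₁ f D.≈ F₁ g

Π-Cat : ∀ {o ℓ e} {n : ℕ} → (Fin n → Category o ℓ e) → Category o ℓ e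
Π-Cat {n = n} C = record
  { Obj       = (i : Fin n) → Category.Obj (C i)
  ; _⇒_       = λ A B → (i : Fin n) → Category._⇒_ (C i) (A i) (B i)
  ; _≈_       = λ f g → (i : Fin n) → Category._≈_ (C i) (f i) (g i)
  ; id        = λ i → Category.id (C i)
  ; _∘_       = λ f g i → Category._∘_ (C i) (f i) (g i)
  ; equiv     = record
      { refl  = λ i → Category.refl (C i)
      ; sym   = λ p i → Category.sym (C i) (p i)
      ; trans = λ p q i → Category.trans (C i) (p i) (q i) }
  ; ∘-resp-≈  = λ p q i → Category.∘-resp-≈ (C i) (p i) (q i)
  ; assoc     = λ i → Category.assoc (C i)
  ; identityˡ = λ i → Category.identityˡ (C i)
  ; identityʳ = λ i → Category.identityʳ (C i)
  }

record Comonad {o ℓ e} (C : Category o ℓ e) : Set (o ⊔ ℓ ⊔ e) where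
  open Category C
  field
    F : Functor C C
  open Functor F public
  field
    ε        : ∀ A → F₀ A ⇒ A
    δ        : ∀ A → F₀ A ⇒ F₀ (F₀ A)
    ε-natural : ∀ {A B} (f : A ⇒ B) → f ∘ ε A ≈ ε B ∘ F₁ f
    δ-natural : ∀ {A B} (f : A ⇒ B) → F₁ (F₁ f) ∘ δ A ≈ δ B ∘ F₁ f
    identityˡ-law : ∀ A → ε (F₀ A) ∘ δ A ≈ id
    identityʳ-law : ∀ A → F₁ (ε A) ∘ δ A ≈ id
    assoc-law     : ∀ A → δ (F₀ A) ∘ δ A ≈ F₁ (δ A) ∘ δ A

module _ {o ℓ e} {C : Category o ℓ e} (ℂ : Comonad C) where
  open Category C
  open Comonad ℂ

  record Coalgebra : Set (o ⊔ ℓ ⊔ e) where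
    field
      carrier : Obj
      coalg   : carrier ⇒ F₀ carrier
      counit  : ε carrier ∘ coalg ≈ id
      coassoc : δ carrier ∘ coalg ≈ F₁ coalg ∘ coalg

  open Coalgebra

  record CoalgHom (X Y : Coalgebra) : Set (ℓ ⊔ e) where
    field
      hom     : carrier X ⇒ carrier Y
      commute : coalg Y ∘ hom ≈ F₁ hom ∘ coalg X

  open CoalgHom

  cofree : Obj → Coalgebra
  cofree A = record
    { carrier = F₀ A ; coalg = δ A
    ; counit = identityˡ-law A ; coassoc = assoc-law A }

  -- Equaliser in EM(ℂ) of a parallel pair of coalgebra morphisms.
  -- (Equality of morphisms in EM(ℂ) is equality of the underlying morphisms,
  --  and composition is composition of underlying morphisms.)
  record EMEqualiser {X Y : Coalgebra} (f g : CoalgHom X Y) : Set (o ⊔ ℓ ⊔ e) where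
    field
      obj       : Coalgebra
      arr       : CoalgHom obj X
      equality  : hom f ∘ hom arr ≈ hom g ∘ hom arr
      factor    : ∀ {Z} (h : CoalgHom Z X) → hom f ∘ hom h ≈ hom g ∘ hom h →
                  CoalgHom Z obj
      factor-eq : ∀ {Z} (h : CoalgHom Z X) (p : hom f ∘ hom h ≈ hom g ∘ hom h) →
                  hom arr ∘ hom (factor h p) ≈ hom h
      unique    : ∀ {Z} (h : CoalgHom Z X) (k : CoalgHom Z obj) →
                  hom arr ∘ hom k ≈ hom h →
                  (p : hom f ∘ hom h ≈ hom g ∘ hom h) → hom k ≈ hom (factor h p)

  HasEMEqualisers : Set (o ⊔ ℓ ⊔ e)
  HasEMEqualisers = ∀ {X Y : Coalgebra} (f g : CoalgHom X Y) → EMEqualiser f g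

open Coalgebra public
open CoalgHom public

module _ {o ℓ e o′ ℓ′ e′} {n : ℕ} {C : Fin n → Category o ℓ e}
         {D : Category o′ ℓ′ e′}
         (ℂ : (i : Fin n) → Comonad (C i)) (𝔻 : Comonad D)
         (H : Functor (Π-Cat C) D) where
  private
    module P = Category (Π-Cat C)
    module ℂ i = Comonad (ℂ i)
  open Category D
  module 𝔻 = Comonad 𝔻
  open Functor H renaming (F₀ to H₀; F₁ to H₁)

  ℂ₀ : P.Obj → P.Obj
  ℂ₀ A i = ℂ.F₀ i (A i)

  ℂ₁ : ∀ {A B} → A P.⇒ B → ℂ₀ A P.⇒ ℂ₀ B
  ℂ₁ f i = ℂ.F₁ i (f i)

  record KleisliLaw : Set (o ⊔ ℓ ⊔ e ⊔ o′ ⊔ ℓ′ ⊔ e′) where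
    field
      κ         : ∀ (A : P.Obj) → 𝔻.F₀ (H₀ A) ⇒ H₀ (ℂ₀ A)
      natural   : ∀ {A B} (f : A P.⇒ B) → H₁ (ℂ₁ f) ∘ κ A ≈ κ B ∘ 𝔻.F₁ (H₁ f)
      counit-law : ∀ A → H₁ (λ i → ℂ.ε i (A i)) ∘ κ A ≈ 𝔻.ε (H₀ A)
      comult-law : ∀ A → H₁ (λ i → ℂ.δ i (A i)) ∘ κ A
                         ≈ κ (ℂ₀ A) ∘ (𝔻.F₁ (κ A) ∘ 𝔻.δ (H₀ A))

  module _ (K : KleisliLaw) (β : (i : Fin n) → Coalgebra (ℂ i)) where
    open KleisliLaw K

    B⃗ : P.Obj
    B⃗ i = carrier (β i)

    β⃗ : B⃗ P.⇒ ℂ₀ B⃗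
    β⃗ i = coalg (β i)

    open HomReasoning

    pairL : CoalgHom 𝔻 (cofree 𝔻 (H₀ B⃗)) (cofree 𝔻 (H₀ (ℂ₀ B⃗)))
    pairL = record
      { hom = 𝔻.F₁ (κ B⃗) ∘ 𝔻.δ (H₀ B⃗)
      ; commute = begin
          𝔻.δ _ ∘ (𝔻.F₁ (κ B⃗) ∘ 𝔻.δ _)
            ≈⟨ sym assoc ⟩
          (𝔻.δ _ ∘ 𝔻.F₁ (κ B⃗)) ∘ 𝔻.δ _
            ≈⟨ ∘-resp-≈ (sym (𝔻.δ-natural (κ B⃗))) refl ⟩
          (𝔻.F₁ (𝔻.F₁ (κ B⃗)) ∘ 𝔻.δ _) ∘ 𝔻.δ _
            ≈⟨ assoc ⟩
          𝔻.F₁ (𝔻.F₁ (κ B⃗)) ∘ (𝔻.δ _ ∘ 𝔻.δ _)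
            ≈⟨ ∘-resp-≈ refl (𝔻.assoc-law _) ⟩
          𝔻.F₁ (𝔻.F₁ (κ B⃗)) ∘ (𝔻.F₁ (𝔻.δ _) ∘ 𝔻.δ _)
            ≈⟨ sym assoc ⟩
          (𝔻.F₁ (𝔻.F₁ (κ B⃗)) ∘ 𝔻.F₁ (𝔻.δ _)) ∘ 𝔻.δ _
            ≈⟨ ∘-resp-≈ (sym 𝔻.homomorphism) refl ⟩
          𝔻.F₁ (𝔻.F₁ (κ B⃗) ∘ 𝔻.δ _) ∘ 𝔻.δ _ ∎ }

    pairR : CoalgHom 𝔻 (cofree 𝔻 (H₀ B⃗)) (cofree 𝔻 (H₀ (ℂ₀ B⃗)))
    pairR = record
      { hom = 𝔻.F₁ (H₁ β⃗)
      ; commute = sym (𝔻.δ-natural (H₁ β⃗)) }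

    IsBimorphism : (A : Coalgebra 𝔻) → carrier A ⇒ H₀ B⃗ → Set e′
    IsBimorphism A g = H₁ β⃗ ∘ g ≈ κ B⃗ ∘ (𝔻.F₁ g ∘ coalg A)

    module _ (eqs : HasEMEqualisers 𝔻) where
      private
        module E = EMEqualiser (eqs pairL pairR)

      Ĥ : Coalgebra 𝔻
      Ĥ = E.obj

      ι : CoalgHom 𝔻 Ĥ (cofree 𝔻 (H₀ B⃗))
      ι = E.arr

      u : carrier Ĥ ⇒ H₀ B⃗
      u = 𝔻.ε (H₀ B⃗) ∘ hom ι

      _♯ : ∀ {A : Coalgebra 𝔻} → CoalgHom 𝔻 A Ĥ → carrier A ⇒ H₀ B⃗
      f ♯ = u ∘ hom f

      record SharpIsBijection (A : Coalgebra 𝔻) : Set (o′ ⊔ ℓ′ ⊔ e′) where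
        field
          well-defined : ∀ (f : CoalgHom 𝔻 A Ĥ) → IsBimorphism A (f ♯)
          cong-♯       : ∀ (f f′ : CoalgHom 𝔻 A Ĥ) →
                         hom f ≈ hom f′ → f ♯ ≈ f′ ♯
          injective    : ∀ (f f′ : CoalgHom 𝔻 A Ĥ) →
                         f ♯ ≈ f′ ♯ → hom f ≈ hom f′
          surjective   : ∀ (g : carrier A ⇒ H₀ B⃗) → IsBimorphism A g →
                         Σ[ f ∈ CoalgHom 𝔻 A Ĥ ] f ♯ ≈ g

{-# OPTIONS --safe #-}
-- Coalgebra morphisms h : (A, α) → F^𝔻(X) correspond to morphisms A → X via
-- h ↦ ε ∘ h, with inverse g ↦ 𝔻(g) ∘ α.  Under this correspondence g is a
-- bimorphism exactly when 𝔻(g) ∘ α equalises the pair defining Ĥ(β⃗).  Since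
-- coalgebra morphisms into the equaliser Ĥ(β⃗) are the equalising coalgebra
-- morphisms into F^𝔻(H B⃗), composing the two correspondences gives
-- f ↦ ε ∘ ι ∘ f = f♯.
module Submission where

open import Defs
open import Data.Nat using (ℕ)
open import Data.Fin using (Fin)
open import Data.Product using (_,_)

module Composition {o ℓ e} (C : Category o ℓ e) where
  open Category C

  infixr 4 _⟩∘⟨_ refl⟩∘⟨_
  infixl 5 _⟩∘⟨refl

  _⟩∘⟨_ : ∀ {X Y Z} {f h : Y ⇒ Z} {g i : X ⇒ Y} → f ≈ h → g ≈ i → f ∘ g ≈ h ∘ i
  _⟩∘⟨_ = ∘-resp-≈

  refl⟩∘⟨_ : ∀ {X Y Z} {f : Y ⇒ Z} {g i : X ⇒ Y} → g ≈ i → f ∘ g ≈ f ∘ i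
  refl⟩∘⟨ p = refl ⟩∘⟨ p

  _⟩∘⟨refl : ∀ {X Y Z} {f h : Y ⇒ Z} {g : X ⇒ Y} → f ≈ h → f ∘ g ≈ h ∘ g
  p ⟩∘⟨refl = p ⟩∘⟨ refl

module CoalgebraProperties {o ℓ e} {C : Category o ℓ e} (𝔻 : Comonad C) where
  open Category C
  open HomReasoning
  open Composition C
  open Comonad 𝔻

  infixr 9 _∘ᶜ_

  _∘ᶜ_ : ∀ {X Y Z : Coalgebra 𝔻} → CoalgHom 𝔻 Y Z → CoalgHom 𝔻 X Y → CoalgHom 𝔻 X Z
  _∘ᶜ_ {X} {Y} {Z} g f = record
    { hom     = hom g ∘ hom f
    ; commute = begin
        coalg Z ∘ (hom g ∘ hom f)            ≈⟨ sym assoc ⟩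
        (coalg Z ∘ hom g) ∘ hom f            ≈⟨ commute g ⟩∘⟨refl ⟩
        (F₁ (hom g) ∘ coalg Y) ∘ hom f       ≈⟨ assoc ⟩
        F₁ (hom g) ∘ (coalg Y ∘ hom f)       ≈⟨ refl⟩∘⟨ commute f ⟩
        F₁ (hom g) ∘ (F₁ (hom f) ∘ coalg X)  ≈⟨ sym assoc ⟩
        (F₁ (hom g) ∘ F₁ (hom f)) ∘ coalg X  ≈⟨ sym homomorphism ⟩∘⟨refl ⟩
        F₁ (hom g ∘ hom f) ∘ coalg X         ∎ }

  extend : ∀ {X} (A : Coalgebra 𝔻) → carrier A ⇒ X → CoalgHom 𝔻 A (cofree 𝔻 X)
  extend A g = record
    { hom     = F₁ g ∘ coalg A
    ; commute = begin
        δ _ ∘ (F₁ g ∘ coalg A)                ≈⟨ sym assoc ⟩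
        (δ _ ∘ F₁ g) ∘ coalg A                ≈⟨ sym (δ-natural g) ⟩∘⟨refl ⟩
        (F₁ (F₁ g) ∘ δ _) ∘ coalg A           ≈⟨ assoc ⟩
        F₁ (F₁ g) ∘ (δ _ ∘ coalg A)           ≈⟨ refl⟩∘⟨ coassoc A ⟩
        F₁ (F₁ g) ∘ (F₁ (coalg A) ∘ coalg A)  ≈⟨ sym assoc ⟩
        (F₁ (F₁ g) ∘ F₁ (coalg A)) ∘ coalg A  ≈⟨ sym homomorphism ⟩∘⟨refl ⟩
        F₁ (F₁ g ∘ coalg A) ∘ coalg A         ∎ }

  ε∘extend : ∀ {X} (A : Coalgebra 𝔻) (g : carrier A ⇒ X) → ε X ∘ hom (extend A g) ≈ g
  ε∘extend A g = begin
    ε _ ∘ (F₁ g ∘ coalg A)  ≈⟨ sym assoc ⟩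
    (ε _ ∘ F₁ g) ∘ coalg A  ≈⟨ sym (ε-natural g) ⟩∘⟨refl ⟩
    (g ∘ ε _) ∘ coalg A     ≈⟨ assoc ⟩
    g ∘ (ε _ ∘ coalg A)     ≈⟨ refl⟩∘⟨ counit A ⟩
    g ∘ id                  ≈⟨ identityʳ ⟩
    g                       ∎

  cofree-η : ∀ {X} {A : Coalgebra 𝔻} (h : CoalgHom 𝔻 A (cofree 𝔻 X)) →
             hom h ≈ hom (extend A (ε X ∘ hom h))
  cofree-η {X} {A} h = begin
    hom h                              ≈⟨ sym identityˡ ⟩
    id ∘ hom h                         ≈⟨ sym (identityʳ-law X) ⟩∘⟨refl ⟩
    (F₁ (ε X) ∘ δ X) ∘ hom h           ≈⟨ assoc ⟩
    F₁ (ε X) ∘ (δ X ∘ hom h)           ≈⟨ refl⟩∘⟨ commute h ⟩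
    F₁ (ε X) ∘ (F₁ (hom h) ∘ coalg A)  ≈⟨ sym assoc ⟩
    (F₁ (ε X) ∘ F₁ (hom h)) ∘ coalg A  ≈⟨ sym homomorphism ⟩∘⟨refl ⟩
    F₁ (ε X ∘ hom h) ∘ coalg A         ∎

  cofree-hom-unique : ∀ {X} {A : Coalgebra 𝔻} (h h′ : CoalgHom 𝔻 A (cofree 𝔻 X)) →
                      ε X ∘ hom h ≈ ε X ∘ hom h′ → hom h ≈ hom h′
  cofree-hom-unique h h′ p = begin
    hom h                  ≈⟨ cofree-η h ⟩
    F₁ (ε _ ∘ hom h) ∘ _   ≈⟨ F-resp-≈ p ⟩∘⟨refl ⟩
    F₁ (ε _ ∘ hom h′) ∘ _  ≈⟨ sym (cofree-η h′) ⟩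
    hom h′                 ∎

module EMEqualiserProperties {o ℓ e} {C : Category o ℓ e} {𝔻 : Comonad C}
    {X Y : Coalgebra 𝔻} {f g : CoalgHom 𝔻 X Y} (E : EMEqualiser 𝔻 f g) where
  open Category C
  open Composition C
  open CoalgebraProperties 𝔻
  open EMEqualiser E

  equality-∘ : ∀ {Z} (k : CoalgHom 𝔻 Z obj) →
               hom f ∘ hom (arr ∘ᶜ k) ≈ hom g ∘ hom (arr ∘ᶜ k)
  equality-∘ k = trans (sym assoc) (trans (equality ⟩∘⟨refl) assoc)

  arr-mono : ∀ {Z} (k k′ : CoalgHom 𝔻 Z obj) →
             hom arr ∘ hom k ≈ hom arr ∘ hom k′ → hom k ≈ hom k′
  arr-mono k k′ p = trans (unique (arr ∘ᶜ k) k refl (equality-∘ k))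
                          (sym (unique (arr ∘ᶜ k) k′ (sym p) (equality-∘ k)))

module Bimorphisms {o ℓ e o′ ℓ′ e′} {n : ℕ}
    {C : Fin n → Category o ℓ e} {D : Category o′ ℓ′ e′}
    (ℂ : (i : Fin n) → Comonad (C i)) (𝔻 : Comonad D)
    (H : Functor (Π-Cat C) D) (K : KleisliLaw ℂ 𝔻 H)
    (β : (i : Fin n) → Coalgebra (ℂ i)) (A : Coalgebra 𝔻) where
  open Category D
  open HomReasoning
  open Composition D
  open CoalgebraProperties 𝔻
  open Functor H using () renaming (F₀ to H₀; F₁ to H₁)
  open KleisliLaw K
  open Comonad 𝔻 using (ε; δ; ε-natural; identityˡ-law; F-resp-≈) renaming (F₁ to 𝔻₁)

  private
    B : Category.Obj (Π-Cat C)
    B = B⃗ ℂ 𝔻 H K β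

    Hβ : H₀ B ⇒ H₀ (ℂ₀ ℂ 𝔻 H B)
    Hβ = H₁ (β⃗ ℂ 𝔻 H K β)

    L R : CoalgHom 𝔻 (cofree 𝔻 (H₀ B)) (cofree 𝔻 (H₀ (ℂ₀ ℂ 𝔻 H B)))
    L = pairL ℂ 𝔻 H K β
    R = pairR ℂ 𝔻 H K β

  ε∘pairL : ε _ ∘ hom L ≈ κ B
  ε∘pairL = begin
    ε _ ∘ (𝔻₁ (κ B) ∘ δ _)  ≈⟨ sym assoc ⟩
    (ε _ ∘ 𝔻₁ (κ B)) ∘ δ _  ≈⟨ sym (ε-natural (κ B)) ⟩∘⟨refl ⟩
    (κ B ∘ ε _) ∘ δ _       ≈⟨ assoc ⟩
    κ B ∘ (ε _ ∘ δ _)       ≈⟨ refl⟩∘⟨ identityˡ-law _ ⟩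
    κ B ∘ id                ≈⟨ identityʳ ⟩
    κ B                     ∎

  ε∘pairR : ε _ ∘ hom R ≈ Hβ ∘ ε _
  ε∘pairR = sym (ε-natural Hβ)

  IsBimorphism-resp-≈ : ∀ {g g′} → g ≈ g′ → IsBimorphism ℂ 𝔻 H K β A g →
                        IsBimorphism ℂ 𝔻 H K β A g′
  IsBimorphism-resp-≈ {g} {g′} p bim = begin
    Hβ ∘ g′                  ≈⟨ refl⟩∘⟨ sym p ⟩
    Hβ ∘ g                   ≈⟨ bim ⟩
    κ B ∘ (𝔻₁ g ∘ coalg A)   ≈⟨ refl⟩∘⟨ F-resp-≈ p ⟩∘⟨refl ⟩
    κ B ∘ (𝔻₁ g′ ∘ coalg A)  ∎

  equalising⇒bimorphism : (h : CoalgHom 𝔻 A (cofree 𝔻 (H₀ B))) →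
                          hom L ∘ hom h ≈ hom R ∘ hom h →
                          IsBimorphism ℂ 𝔻 H K β A (ε _ ∘ hom h)
  equalising⇒bimorphism h p = begin
    Hβ ∘ (ε _ ∘ hom h)                  ≈⟨ sym assoc ⟩
    (Hβ ∘ ε _) ∘ hom h                  ≈⟨ sym ε∘pairR ⟩∘⟨refl ⟩
    (ε _ ∘ hom R) ∘ hom h               ≈⟨ assoc ⟩
    ε _ ∘ (hom R ∘ hom h)               ≈⟨ refl⟩∘⟨ sym p ⟩
    ε _ ∘ (hom L ∘ hom h)               ≈⟨ sym assoc ⟩
    (ε _ ∘ hom L) ∘ hom h               ≈⟨ ε∘pairL ⟩∘⟨refl ⟩
    κ B ∘ hom h                         ≈⟨ refl⟩∘⟨ cofree-η h ⟩
    κ B ∘ hom (extend A (ε _ ∘ hom h))  ∎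

  bimorphism⇒extend-equalising : ∀ {g} → IsBimorphism ℂ 𝔻 H K β A g →
                                 hom L ∘ hom (extend A g) ≈ hom R ∘ hom (extend A g)
  bimorphism⇒extend-equalising {g} bim =
    cofree-hom-unique (L ∘ᶜ extend A g) (R ∘ᶜ extend A g) (begin
      ε _ ∘ (hom L ∘ hom (extend A g))  ≈⟨ sym assoc ⟩
      (ε _ ∘ hom L) ∘ hom (extend A g)  ≈⟨ ε∘pairL ⟩∘⟨refl ⟩
      κ B ∘ hom (extend A g)            ≈⟨ sym bim ⟩
      Hβ ∘ g                            ≈⟨ refl⟩∘⟨ sym (ε∘extend A g) ⟩
      Hβ ∘ (ε _ ∘ hom (extend A g))     ≈⟨ sym assoc ⟩
      (Hβ ∘ ε _) ∘ hom (extend A g)     ≈⟨ sym ε∘pairR ⟩∘⟨refl ⟩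
      (ε _ ∘ hom R) ∘ hom (extend A g)  ≈⟨ assoc ⟩
      ε _ ∘ (hom R ∘ hom (extend A g))  ∎)

proposition6p3 : ∀ {o ℓ e o′ ℓ′ e′} {n : ℕ}
    (C : Fin n → Category o ℓ e) (D : Category o′ ℓ′ e′)
    (ℂ : (i : Fin n) → Comonad (C i)) (𝔻 : Comonad D)
    (H : Functor (Π-Cat C) D) (κ : KleisliLaw ℂ 𝔻 H)
    (eqs : HasEMEqualisers 𝔻)
    (β : (i : Fin n) → Coalgebra (ℂ i)) (A : Coalgebra 𝔻) →
    SharpIsBijection ℂ 𝔻 H κ β eqs A
proposition6p3 C D ℂ 𝔻 H κ eqs β A = record
  { well-defined = λ f →
      IsBimorphism-resp-≈ (sym assoc) (equalising⇒bimorphism (arr ∘ᶜ f) (equality-∘ f))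
  ; cong-♯       = λ _ _ → refl⟩∘⟨_
  ; injective    = λ f f′ p →
      arr-mono f f′ (cofree-hom-unique (arr ∘ᶜ f) (arr ∘ᶜ f′)
                                       (trans (sym assoc) (trans p assoc)))
  ; surjective   = λ g bim →
      let f = factor (extend A g) (bimorphism⇒extend-equalising bim) in
      f , trans assoc (trans (refl⟩∘⟨ factor-eq _ _) (ε∘extend A g))
  }
  where
    open Category D
    open Composition D
    open CoalgebraProperties 𝔻
    open Bimorphisms ℂ 𝔻 H κ β A

    E : EMEqualiser 𝔻 (pairL ℂ 𝔻 H κ β) (pairR ℂ 𝔻 H κ β)
    E = eqs _ _
    open EMEqualiser E using (arr; factor; factor-eq)
    open EMEqualiserProperties E
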